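{- Let $\Gamma,\Delta,\Phi$ be theory presentations, let $[u_\Delta]:\Gamma\to\Delta$ and $[u_\Phi]:\Gamma\to\Phi$ be embeddings, and write $\Delta=\Gamma[u_\Delta]\rtimes\Delta^+$ and $\Phi=\Gamma[u_\Phi]\rtimes\Phi^+$. Let $\pi_\Delta:|\Delta|\to\mathcal V$ and $\pi_\Phi:|\Phi|\to\mathcal V$ be injective renaming functions satisfying the combine condition: for all $x\in|\Delta|$, $y\in|\Phi|$, $$\pi_\Delta(x)=\pi_\Phi(y)\iff \exists z\in|\Gamma|.\; x=z[u_\Delta]\wedge y=z[u_\Phi].$$ Let $\pi_{\Phi^+}:|\Phi^+|\to\mathcal V$ be the restriction of $\pi_\Phi$ to $|\Phi^+|$. Then $$\mathrm{mixin}(u_\Delta,u_\Phi,\pi_\Delta,\pi_{\Phi^+})=\mathrm{combine}(u_\Delta,u_\Phi,\pi_\Delta,\pi_\Phi),$$ interpreted component-wise: the resulting presentations are equal, the $\mathtt{embed}_\Delta$ components are equal, the $\mathtt{view}_\Phi$ component of the mixin equals the $\mathtt{embed}_\Phi$ component of the combine, the $\mathtt{diag}$ components are equal, and the two $\mathtt{mediate}$ operations produce the same mediating view for every admissible pair $(w_\Delta,w_\Phi)$.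
   Context: Fix a dependent type theory with an infinite set $\mathcal V$ of variable names, typing judgements $\Gamma\vdash s:\sigma$, kinding judgements, a definitional-equality judgement $\Gamma\vdash s_1:\sigma_1\equiv s_2:\sigma_2$, and simultaneous substitution $e[x_i:=s_i]_{i<n}$; for an assignment $v$ write $e[v]$ for its application. A theory presentation (context) is a well-formed list of declarations $x_1:\sigma_1;\dots;x_n:\sigma_n$ with distinct names, each type well-kinded in the preceding prefix; $|\Gamma|$ denotes its set of names. A view $[v]:\Gamma\to\Delta$ assigns to each $a\in|\Gamma|$ (declared $a:\sigma_a$) a term $r_a$ with $\Delta\vdash r_a:\sigma_a[v]$ (substituting the earlier assignments). Composition $[v];[w]:\Gamma\to\Phi$ of $[v]:\Gamma\to\Delta$, $[w]:\Delta\to\Phi$ assigns $a\mapsto r_a[w]$. Two views $[u],[v]:\Gamma\to\Delta$ are equivalent if for every $a$ the assigned terms are definitionally equal in $\Delta$. An embedding $\tilde\pi:\Gamma\to\Delta$ is the view $x\mapsto\pi(x)$ induced by a finite-support bijection $\pi:\mathcal V\to\mathcal V$ such that $\pi^{ -1}$ restricts to an injective map $|\Delta|\to|\Gamma|$; then $\Delta$ decomposes as $\Gamma[u]\rtimes\Delta^+$, i.e. the renamed copy of $\Gamma$ followed by the remaining declarations $\Delta^+$ (which may depend on earlier ones). For an injective $\pi$ on names, $\pi(\Gamma)$ (or $\Gamma[x\mapsto\pi(x)]$) denotes $\Gamma$ with every name $x$ renamed to $\pi(x)$ throughout. Combine: given embeddings $[u_\Delta]:\Gamma\to\Delta$, $[u_\Phi]:\Gamma\to\Phi$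 and injective $\pi_\Delta:|\Delta|\to\mathcal V$, $\pi_\Phi:|\Phi|\to\mathcal V$ satisfying the combine condition above, $\mathrm{combine}(u_\Delta,u_\Phi,\pi_\Delta,\pi_\Phi)$ is the record with: $\mathtt{pres}=\Xi:=\Xi_0\rtimes(\Xi_\Delta\cup\Xi_\Phi)$, where $\Xi_0$ is $\Gamma$ with each $z$ renamed to $\pi_\Delta(z[u_\Delta])$, $\Xi_\Delta$ is $\Delta^+$ with all names of $\Delta$ renamed by $\pi_\Delta$, $\Xi_\Phi$ is $\Phi^+$ with all names of $\Phi$ renamed by $\pi_\Phi$, and $\Xi_0\rtimes(\Xi_\Delta\cup\Xi_\Phi)$ denotes the presentation $\Xi_0\rtimes\Xi_\Delta\rtimes\Xi_\Phi$ identified with $\Xi_0\rtimes\Xi_\Phi\rtimes\Xi_\Delta$; $\mathtt{embed}_\Delta=[v_\Delta]:=\tilde\pi_\Delta:\Delta\to\Xi$; $\mathtt{embed}_\Phi=[v_\Phi]:=\tilde\pi_\Phi:\Phi\to\Xi$; $\mathtt{diag}=[u_\Delta];[v_\Delta]\;(=[u_\Phi];[v_\Phi]):\Gamma\to\Xi$; and $\mathtt{mediate}$ sends views $[w_\Delta]:\Delta\to\Omega$, $[w_\Phi]:\Phi\to\Omega$ with $[u_\Delta];[w_\Delta]$ equivalent to $[u_\Phi];[w_\Phi]$ to the view $[w_\Xi]:\Xi\to\Omega$ given by $\pi_\Delta(x)\mapsto x[w_\Delta]$ ($x\in|\Delta|$) and $\pi_\Phi(y)\mapsto y[w_\Phi]$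 ($y\in|\Phi|$). Mixin: given an arbitrary view $[u_\Delta]:\Gamma\to\Delta$, an embedding $[u_\Phi]:\Gamma\to\Phi$ with $\Phi=\Gamma[u_\Phi]\rtimes\Phi^+$, and injective renamings $\pi_\Delta:|\Delta|\to\mathcal V$, $\pi_{\Phi^+}:|\Phi^+|\to\mathcal V$ with disjoint images, define $\pi'_\Phi$ on $|\Phi|$ by $\pi'_\Phi(y)=z[u_\Delta][x\mapsto\pi_\Delta(x)]_{x\in|\Delta|}$ if $y=z[u_\Phi]$ for some $z\in|\Gamma|$, and $\pi'_\Phi(y)=\pi_{\Phi^+}(y)$ if $y\in|\Phi^+|$. Then $\mathrm{mixin}(u_\Delta,u_\Phi,\pi_\Delta,\pi_{\Phi^+})$ is the record with: $\mathtt{pres}=\Xi:=\Xi_1\rtimes\Xi_2$, where $\Xi_1=\pi_\Delta(\Delta)$ and $\Xi_2$ is $\Phi^+$ with every symbol $y$ of $\Phi$ replaced by $\pi'_\Phi(y)$; $\mathtt{embed}_\Delta=[v_\Delta]:=\tilde\pi_\Delta:\Delta\to\Xi$; $\mathtt{view}_\Phi=[v_\Phi]:\Phi\to\Xi$, the view $y\mapsto\pi'_\Phi(y)$; $\mathtt{diag}=[u_\Delta];[v_\Delta]\;(=[u_\Phi];[v_\Phi]):\Gamma\to\Xi$; and $\mathtt{mediate}$ sends views $[w_\Delta]:\Delta\to\Omega$, $[w_\Phi]:\Phi\to\Omega$ with $[u_\Delta];[w_\Delta]$ equivalent to $[u_\Phi];[w_\Phi]$ to the view $[w_\Xi]:\Xi\to\Omega$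 given by $\pi_\Delta(x)\mapsto x[w_\Delta]$ ($x\in|\Delta|$) and $\pi'_\Phi(y)\mapsto y[w_\Phi]$ ($y\in|\Phi^+|$). -}

module Defs where

open import Data.List using (List; []; _∷_; _++_; map)
open import Data.List.Membership.Propositional using (_∈_; _∉_)
open import Data.Product using (Σ; _×_; _,_; proj₁; proj₂)
open import Data.Maybe using (Maybe; just; nothing)
open import Data.Unit using (⊤)
open import Function using (_∘_)
open import Relation.Binary.PropositionalEquality using (_≡_)
open import Relation.Binary.Definitions using (DecidableEquality)
open import Relation.Nullary using (yes; no)

-- Expressions (terms, types, kinds) form one syntactic category Tm, taken
-- up to alpha-equivalence, so that _≡_ is syntactic identity of expressions.
-- e [ s ] is simultaneous (capture-avoiding) substitution by a total
-- assignment s : V → Tm (variables are replaced by s x).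
record TypeTheory : Set₁ where
  infixl 8 _[_]
  field
    V        : Set
    _≟V_     : DecidableEquality V
    -- V is infinite: every finite list of names misses some name
    fresh    : List V → V
    fresh-∉  : ∀ xs → fresh xs ∉ xs

    Tm       : Set
    var      : V → Tm
    _[_]     : Tm → (V → Tm) → Tm
    fv       : Tm → List V
    sub-var  : ∀ x s → var x [ s ] ≡ s x
    sub-cong : ∀ e s t → (∀ x → x ∈ fv e → s x ≡ t x) → e [ s ] ≡ e [ t ]
    sub-comp : ∀ e s t → e [ s ] [ t ] ≡ e [ (λ x → s x [ t ]) ]

    -- judgements; a context is a list of declarations, first declaration first
    _⊢_∶_       : List (V × Tm) → Tm → Tm → Set
    _⊢ₖ_∶_      : List (V × Tm) → Tm → Tm → Set
    _⊢_∶_≡_∶_   : List (V × Tm) → Tm → Tm → Tm → Tm → Set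
    kind-fv  : ∀ Γ σ κ → Γ ⊢ₖ σ ∶ κ → ∀ x → x ∈ fv σ → x ∈ map proj₁ Γ

module Theory (T : TypeTheory) where
  open TypeTheory T public

  open import Data.List.Membership.DecPropositional _≟V_ using (_∈?_)

  Ctx : Set
  Ctx = List (V × Tm)

  names : Ctx → List V
  names = map proj₁

  WFfrom : Ctx → Ctx → Set
  WFfrom P []            = ⊤
  WFfrom P ((x , σ) ∷ R) =
    (x ∉ names P) × (Σ Tm (λ κ → P ⊢ₖ σ ∶ κ)) × WFfrom (P ++ ((x , σ) ∷ [])) R

  WF : Ctx → Set
  WF Γ = WFfrom [] Γ

  -- a view Γ → Δ: an assignment of terms to names (only values on |Γ| matter)
  View : Set
  View = V → Tm

  restrict : Ctx → View → V → Tm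
  restrict Γ v x with x ∈? names Γ
  ... | yes _ = v x
  ... | no _  = var x

  apply : Ctx → View → Tm → Tm
  apply Γ v e = e [ restrict Γ v ]

  IsView : Ctx → Ctx → View → Set
  IsView Γ Δ v = ∀ a σ → (a , σ) ∈ Γ → Δ ⊢ v a ∶ apply Γ v σ

  ViewEquiv : Ctx → Ctx → View → View → Set
  ViewEquiv Γ Δ u v = ∀ a σ → (a , σ) ∈ Γ →
    Δ ⊢ u a ∶ apply Γ u σ ≡ v a ∶ apply Γ v σ

  ViewEq : Ctx → View → View → Set
  ViewEq Γ u v = ∀ a → a ∈ names Γ → u a ≡ v a

  compose : Ctx → View → View → View
  compose Δ v w a = apply Δ w (v a)

  substCtx : (V → V) → (V → Tm) → Ctx → Ctx
  substCtx f s = map (λ d → f (proj₁ d) , proj₂ d [ s ])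

  rename : Ctx → (V → V) → Ctx
  rename Γ f = substCtx f (restrict Γ (var ∘ f)) Γ

  InjectiveOn : List V → (V → V) → Set
  InjectiveOn xs f = ∀ x y → x ∈ xs → y ∈ xs → f x ≡ f y → x ≡ y

  -- an embedding Γ → Δ: the view x ↦ u x for a finite-support bijection u,
  -- with Δ = Γ[u] ⋊ Δ⁺ (⋊ is concatenation of declaration lists)
  record Embedding (Γ Δ : Ctx) : Set where
    field
      u              : V → V
      u⁻¹            : V → V
      inv-l          : ∀ x → u⁻¹ (u x) ≡ x
      inv-r          : ∀ x → u (u⁻¹ x) ≡ x
      support        : List V
      finite-support : ∀ x → x ∉ support → u x ≡ x
      rest           : Ctx
      decomp         : Δ ≡ rename Γ u ++ rest
      isView         : IsView Γ Δ (var ∘ u)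

  invert : (V → V) → List V → V → Maybe V
  invert f [] n = nothing
  invert f (x ∷ xs) n with f x ≟V n
  ... | yes _ = just x
  ... | no _  = invert f xs n

  record Result : Set where
    field
      pres    : Ctx
      embedΔ  : View
      viewΦ   : View          -- view_Φ (mixin) / embed_Φ (combine)
      diag    : View
      mediate : View → View → View

  mixin : (Γ Δ : Ctx) (uΦ : V → V) (Φ⁺ : Ctx) (uΔ : View) (πΔ πΦ⁺ : V → V) → Result
  mixin Γ Δ uΦ Φ⁺ uΔ πΔ πΦ⁺ = record
    { pres    = Ξ₁ ++ Ξ₂
    ; embedΔ  = var ∘ πΔ
    ; viewΦ   = π'
    ; diag    = compose Δ uΔ (var ∘ πΔ)
    ; mediate = med
    }
    where
      Φ : Ctx
      Φ = rename Γ uΦ ++ Φ⁺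
      π' : View
      π' y with invert uΦ (names Γ) y
      ... | just z  = apply Δ (var ∘ πΔ) (apply Γ uΔ (var z))
      ... | nothing = var (πΦ⁺ y)
      Ξ₁ : Ctx
      Ξ₁ = rename Δ πΔ
      Ξ₂ : Ctx
      Ξ₂ = substCtx πΦ⁺ (restrict Φ π') Φ⁺
      med : View → View → View
      med wΔ wΦ n with invert πΔ (names Δ) n
      ... | just x  = apply Δ wΔ (var x)
      ... | nothing with invert πΦ⁺ (names Φ⁺) n
      ...   | just y  = apply Φ wΦ (var y)
      ...   | nothing = var n

  -- combine(uΔ, uΦ, πΔ, πΦ) for embeddings with Δ = Γ[uΔ] ⋊ Δ⁺, Φ = Γ[uΦ] ⋊ Φ⁺.
  -- pres is the representative Ξ₀ ⋊ Ξ_Δ ⋊ Ξ_Φ; mediate uses the Δ-clause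
  -- on names in the image of both πΔ and πΦ.
  combine : (Γ Δ⁺ Φ⁺ : Ctx) (uΔ uΦ πΔ πΦ : V → V) → Result
  combine Γ Δ⁺ Φ⁺ uΔ uΦ πΔ πΦ = record
    { pres    = Ξ₀ ++ ΞΔ ++ ΞΦ
    ; embedΔ  = var ∘ πΔ
    ; viewΦ   = var ∘ πΦ
    ; diag    = compose Δ (var ∘ uΔ) (var ∘ πΔ)
    ; mediate = med
    }
    where
      Δ : Ctx
      Δ = rename Γ uΔ ++ Δ⁺
      Φ : Ctx
      Φ = rename Γ uΦ ++ Φ⁺
      Ξ₀ : Ctx
      Ξ₀ = rename Γ (πΔ ∘ uΔ)
      ΞΔ : Ctx
      ΞΔ = substCtx πΔ (restrict Δ (var ∘ πΔ)) Δ⁺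
      ΞΦ : Ctx
      ΞΦ = substCtx πΦ (restrict Φ (var ∘ πΦ)) Φ⁺
      med : View → View → View
      med wΔ wΦ n with invert πΔ (names Δ) n
      ... | just x  = apply Δ wΔ (var x)
      ... | nothing with invert πΦ (names Φ) n
      ...   | just y  = apply Φ wΦ (var y)
      ...   | nothing = var n

module Submission where

open import Defs
open import Data.List using (_++_)
open import Data.List.Membership.Propositional using (_∈_)
open import Data.Product using (_×_; ∃)
open import Function using (_∘_)
open import Function.Bundles using (_⇔_)
open import Relation.Binary.PropositionalEquality using (_≡_)

open import Data.List using ([]; _∷_; map)
open import Data.List.Properties using (map-++; map-∘; map-cong; map-cong-local; ++-assoc)
open import Data.List.Membership.Propositional.Properties using (∈-map⁺; ∈-map⁻; ∈-++⁺ˡ)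
open import Data.List.Relation.Unary.Any using (here; there)
open import Data.List.Relation.Unary.All as All using ()
open import Data.Product using (_,_; proj₁)
open import Data.Maybe using (just; nothing)
open import Data.Empty using (⊥-elim)
open import Relation.Nullary using (yes; no; ¬_)
open import Relation.Binary.PropositionalEquality
  using (refl; sym; trans; cong; subst; _≗_; _≢_; module ≡-Reasoning)
open import Function.Bundles using (module Equivalence)

-- Once the embeddings are unfolded (Δ = Γ[uΔ] ⋊ Δ⁺ and
-- Φ = Γ[uΦ] ⋊ Φ⁺), mixin and combine are built from the same pieces, and
-- the only thing that can make them differ is the treatment of the shared
-- part Γ[uΦ] of Φ: mixin sends uΦ z to the πΔ-renamed image of uΔ z, combine
-- sends it to πΦ (uΦ z).  The direction "⇐" of the combine condition says
-- precisely that these names agree: πΔ (uΔ z) ≡ πΦ (uΦ z) for z ∈ |Γ|.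

module _ (T : TypeTheory) where
  open Theory T
  open import Data.List.Membership.DecPropositional _≟V_ using (_∈?_)

  restrict-in : ∀ Γ v {x} → x ∈ names Γ → restrict Γ v x ≡ v x
  restrict-in Γ v {x} x∈Γ with x ∈? names Γ
  ... | yes _   = refl
  ... | no x∉Γ = ⊥-elim (x∉Γ x∈Γ)

  restrict-out : ∀ Γ v {x} → ¬ x ∈ names Γ → restrict Γ v x ≡ var x
  restrict-out Γ v {x} x∉Γ with x ∈? names Γ
  ... | yes x∈Γ = ⊥-elim (x∉Γ x∈Γ)
  ... | no _    = refl

  restrict-cong : ∀ Γ {u v} → ViewEq Γ u v → restrict Γ u ≗ restrict Γ v
  restrict-cong Γ {u} {v} u≡v x with x ∈? names Γ
  ... | yes x∈Γ = u≡v x x∈Γ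
  ... | no _    = refl

  substCtx-cong : ∀ f {s t} R → s ≗ t → substCtx f s R ≡ substCtx f t R
  substCtx-cong f R s≗t =
    map-cong (λ { (x , σ) → cong (f x ,_) (sub-cong σ _ _ (λ a _ → s≗t a)) }) R

  invert-sound : ∀ f xs {n z} → invert f xs n ≡ just z → z ∈ xs × f z ≡ n
  invert-sound f (x ∷ xs) {n} e with f x ≟V n
  invert-sound f (x ∷ xs) refl | yes fx≡n = here refl , fx≡n
  ... | no _ with invert-sound f xs e
  ...   | z∈xs , fz≡n = there z∈xs , fz≡n

  invert-miss : ∀ f xs {n} → invert f xs n ≡ nothing → ∀ {x} → x ∈ xs → f x ≢ n
  invert-miss f (y ∷ xs) {n} e x∈ with f y ≟V n
  invert-miss f (y ∷ xs) () x∈ | yes _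
  invert-miss f (y ∷ xs) e (here refl) | no fy≢n = fy≢n
  invert-miss f (y ∷ xs) e (there x∈) | no _ = invert-miss f xs e x∈

  invert-absent : ∀ f xs {n} → (∀ {x} → x ∈ xs → f x ≢ n) → invert f xs n ≡ nothing
  invert-absent f []       h = refl
  invert-absent f (x ∷ xs) {n} h with f x ≟V n
  ... | yes fx≡n = ⊥-elim (h (here refl) fx≡n)
  ... | no _     = invert-absent f xs (h ∘ there)

  invert-++ : ∀ f xs ys {n} → invert f xs n ≡ nothing → invert f (xs ++ ys) n ≡ invert f ys n
  invert-++ f []       ys e = refl
  invert-++ f (x ∷ xs) ys {n} e with f x ≟V n
  invert-++ f (x ∷ xs) ys () | yes _
  ... | no _ = invert-++ f xs ys e

  names-substCtx : ∀ f s Γ → names (substCtx f s Γ) ≡ map f (names Γ)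
  names-substCtx f s []      = refl
  names-substCtx f s (d ∷ Γ) = cong (f (proj₁ d) ∷_) (names-substCtx f s Γ)

  names-extension : ∀ Γ u R → names (rename Γ u ++ R) ≡ map u (names Γ) ++ names R
  names-extension Γ u R =
    trans (map-++ proj₁ (rename Γ u) R) (cong (_++ names R) (names-substCtx u _ Γ))

  renamed-∈ : ∀ Γ u R {z} → z ∈ names Γ → u z ∈ names (rename Γ u ++ R)
  renamed-∈ Γ u R z∈Γ = subst (_ ∈_) (sym (names-extension Γ u R)) (∈-++⁺ˡ (∈-map⁺ u z∈Γ))

  embedded-∈ : ∀ {Γ Δ} (e : Embedding Γ Δ) {z} → z ∈ names Γ → Embedding.u e z ∈ names Δ
  embedded-∈ {Γ} e z∈Γ =
    subst (λ Δ → _ ∈ names Δ) (sym (Embedding.decomp e)) (renamed-∈ Γ (Embedding.u e) (Embedding.rest e) z∈Γ)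

  wf-scoped : ∀ P R → WFfrom P R → ∀ {x σ a} → (x , σ) ∈ R → a ∈ fv σ → a ∈ names (P ++ R)
  wf-scoped P ((y , τ) ∷ R) (_ , (κ , τ∶κ) , _) (here refl) a∈τ =
    subst (_ ∈_) (sym (map-++ proj₁ P ((y , τ) ∷ R))) (∈-++⁺ˡ (kind-fv P τ κ τ∶κ _ a∈τ))
  wf-scoped P ((y , τ) ∷ R) (_ , _ , wfR) (there d∈R) a∈σ =
    subst (λ Q → _ ∈ names Q) (++-assoc P ((y , τ) ∷ []) R) (wf-scoped (P ++ ((y , τ) ∷ [])) R wfR d∈R a∈σ)

  renamed-twice : ∀ Γ Δ u π {a} → a ∈ names Γ → u a ∈ names Δ →
    restrict Γ (var ∘ u) a [ restrict Δ (var ∘ π) ] ≡ var (π (u a))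
  renamed-twice Γ Δ u π {a} a∈Γ ua∈Δ = begin
    restrict Γ (var ∘ u) a [ restrict Δ (var ∘ π) ] ≡⟨ cong (_[ restrict Δ (var ∘ π) ]) (restrict-in Γ _ a∈Γ) ⟩
    var (u a) [ restrict Δ (var ∘ π) ]               ≡⟨ sub-var _ _ ⟩
    restrict Δ (var ∘ π) (u a)                       ≡⟨ restrict-in Δ _ ua∈Δ ⟩
    var (π (u a))                                    ∎
    where open ≡-Reasoning

  rename-rename : ∀ Γ Δ u π → WF Γ → (∀ {z} → z ∈ names Γ → u z ∈ names Δ) →
    substCtx π (restrict Δ (var ∘ π)) (rename Γ u) ≡ rename Γ (π ∘ u)
  rename-rename Γ Δ u π wfΓ u∈Δ =
    trans (sym (map-∘ Γ)) (map-cong-local (All.tabulate λ { {x , σ} d∈Γ → cong (π (u x) ,_) (type-eq d∈Γ) }))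
    where
      type-eq : ∀ {x σ} → (x , σ) ∈ Γ →
        σ [ restrict Γ (var ∘ u) ] [ restrict Δ (var ∘ π) ] ≡ σ [ restrict Γ (var ∘ π ∘ u) ]
      type-eq {σ = σ} d∈Γ = trans (sub-comp σ _ _) (sub-cong σ _ _ λ a a∈σ →
        let a∈Γ = wf-scoped [] Γ wfΓ d∈Γ a∈σ
        in trans (renamed-twice Γ Δ u π a∈Γ (u∈Δ a∈Γ)) (sym (restrict-in Γ _ a∈Γ)))

  module SharedNames (Γ : Ctx) (wfΓ : WF Γ) (uΔ uΦ : V → V) (Δ⁺ Φ⁺ : Ctx) (πΔ πΦ : V → V)
    (shared : ∀ {z} → z ∈ names Γ → πΔ (uΔ z) ≡ πΦ (uΦ z)) where

    Δ Φ : Ctx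
    Δ = rename Γ uΔ ++ Δ⁺
    Φ = rename Γ uΦ ++ Φ⁺

    M C : Result
    M = mixin Γ Δ uΦ Φ⁺ (var ∘ uΔ) πΔ πΦ
    C = combine Γ Δ⁺ Φ⁺ uΔ uΦ πΔ πΦ

    -- On the shared part uΦ z the mixin view goes through Δ, landing on
    -- πΔ (uΔ z) = πΦ (uΦ z); on Φ⁺ both views are πΦ by definition.
    viewΦ-agree : ViewEq Φ (Result.viewΦ M) (Result.viewΦ C)
    viewΦ-agree y _ with invert uΦ (names Γ) y in found
    ... | nothing = refl
    ... | just z with invert-sound uΦ (names Γ) found
    ...   | z∈Γ , refl = begin
      var z [ restrict Γ (var ∘ uΔ) ] [ restrict Δ (var ∘ πΔ) ]
        ≡⟨ cong (_[ restrict Δ (var ∘ πΔ) ]) (sub-var z _) ⟩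
      restrict Γ (var ∘ uΔ) z [ restrict Δ (var ∘ πΔ) ]
        ≡⟨ renamed-twice Γ Δ uΔ πΔ z∈Γ (renamed-∈ Γ uΔ Δ⁺ z∈Γ) ⟩
      var (πΔ (uΔ z))
        ≡⟨ cong var (shared z∈Γ) ⟩
      var (πΦ (uΦ z))
        ∎
      where open ≡-Reasoning

    -- mixin's Ξ₁ = πΔ(Δ) splits as Ξ₀ ⋊ Ξ_Δ, and its Ξ₂ is Ξ_Φ because the
    -- two views out of Φ used to rename Φ⁺ agree.
    pres-agree : Result.pres M ≡ Result.pres C
    pres-agree = begin
      substCtx πΔ ρΔ (rename Γ uΔ ++ Δ⁺) ++ Ξ₂
        ≡⟨ cong (_++ Ξ₂) (map-++ _ (rename Γ uΔ) Δ⁺) ⟩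
      (substCtx πΔ ρΔ (rename Γ uΔ) ++ ΞΔ) ++ Ξ₂
        ≡⟨ ++-assoc (substCtx πΔ ρΔ (rename Γ uΔ)) ΞΔ Ξ₂ ⟩
      substCtx πΔ ρΔ (rename Γ uΔ) ++ ΞΔ ++ Ξ₂
        ≡⟨ cong (λ Ξ₀ → Ξ₀ ++ ΞΔ ++ Ξ₂) (rename-rename Γ Δ uΔ πΔ wfΓ (renamed-∈ Γ uΔ Δ⁺)) ⟩
      rename Γ (πΔ ∘ uΔ) ++ ΞΔ ++ Ξ₂
        ≡⟨ cong (λ Ξ → rename Γ (πΔ ∘ uΔ) ++ ΞΔ ++ Ξ) (substCtx-cong πΦ Φ⁺ (restrict-cong Φ viewΦ-agree)) ⟩
      rename Γ (πΔ ∘ uΔ) ++ ΞΔ ++ substCtx πΦ (restrict Φ (var ∘ πΦ)) Φ⁺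
        ∎
      where
        open ≡-Reasoning
        ρΔ : V → Tm
        ρΔ = restrict Δ (var ∘ πΔ)
        ΞΔ Ξ₂ : Ctx
        ΞΔ = substCtx πΔ ρΔ Δ⁺
        Ξ₂ = substCtx πΦ (restrict Φ (Result.viewΦ M)) Φ⁺

    -- A name outside πΔ(|Δ|) is not πΦ of a shared name uΦ z, so searching
    -- it in |Φ| amounts to searching it in |Φ⁺|.
    invert-outside-Δ : ∀ {n} → invert πΔ (names Δ) n ≡ nothing →
      invert πΦ (names Φ) n ≡ invert πΦ (names Φ⁺) n
    invert-outside-Δ {n} missΔ = trans (cong (λ xs → invert πΦ xs n) (names-extension Γ uΦ Φ⁺))
      (invert-++ πΦ (map uΦ (names Γ)) (names Φ⁺) (invert-absent πΦ _ not-shared))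
      where
        not-shared : ∀ {y} → y ∈ map uΦ (names Γ) → πΦ y ≢ n
        not-shared y∈ πΦy≡n with ∈-map⁻ uΦ y∈
        ... | z , z∈Γ , refl =
          invert-miss πΔ (names Δ) missΔ (renamed-∈ Γ uΔ Δ⁺ z∈Γ) (trans (shared z∈Γ) πΦy≡n)

    -- Both mediating views look a name up in πΔ(|Δ|) first; otherwise mixin
    -- searches πΦ(|Φ⁺|) and combine πΦ(|Φ|), which give the same result.
    mediate-agree : ∀ wΔ wΦ → ViewEq (Result.pres C) (Result.mediate M wΔ wΦ) (Result.mediate C wΔ wΦ)
    mediate-agree wΔ wΦ n _ with invert πΔ (names Δ) n in missΔ
    ... | just x  = refl
    ... | nothing rewrite invert-outside-Δ missΔ with invert πΦ (names Φ⁺) n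
    ...   | just y  = refl
    ...   | nothing = refl

  -- Component-wise coincidence of two results, mediating views compared
  -- for arbitrary (not only admissible) pairs of views.
  Coincide : (Γ Δ Φ : Ctx) → Result → Result → Set
  Coincide Γ Δ Φ M C =
    Result.pres M ≡ Result.pres C
    × ViewEq Δ (Result.embedΔ M) (Result.embedΔ C)
    × ViewEq Φ (Result.viewΦ M) (Result.viewΦ C)
    × ViewEq Γ (Result.diag M) (Result.diag C)
    × (∀ wΔ wΦ → ViewEq (Result.pres C) (Result.mediate M wΔ wΦ) (Result.mediate C wΔ wΦ))

  mixin≡combine : ∀ {Γ Δ Φ} → WF Γ → (uΔ uΦ : V → V) (Δ⁺ Φ⁺ : Ctx) (πΔ πΦ : V → V) →
    Δ ≡ rename Γ uΔ ++ Δ⁺ → Φ ≡ rename Γ uΦ ++ Φ⁺ →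
    (∀ {z} → z ∈ names Γ → πΔ (uΔ z) ≡ πΦ (uΦ z)) →
    Coincide Γ Δ Φ (mixin Γ Δ uΦ Φ⁺ (var ∘ uΔ) πΔ πΦ) (combine Γ Δ⁺ Φ⁺ uΔ uΦ πΔ πΦ)
  mixin≡combine {Γ} wfΓ uΔ uΦ Δ⁺ Φ⁺ πΔ πΦ refl refl shared =
    pres-agree , (λ _ _ → refl) , viewΦ-agree , (λ _ _ → refl) , mediate-agree
    where open SharedNames Γ wfΓ uΔ uΦ Δ⁺ Φ⁺ πΔ πΦ shared

-- The combine condition (direction ⇐) identifies the two copies of Γ, so
-- mixin≡combine applies to the decompositions carried by the embeddings.
theorem2 : (T : TypeTheory) → let open Theory T in
  (Γ Δ Φ : Ctx) → WF Γ → WF Δ → WF Φ →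
  (eΔ : Embedding Γ Δ) (eΦ : Embedding Γ Φ) →
  (πΔ πΦ : V → V) → InjectiveOn (names Δ) πΔ → InjectiveOn (names Φ) πΦ →
  (∀ x y → x ∈ names Δ → y ∈ names Φ →
    (πΔ x ≡ πΦ y ⇔ ∃ (λ z → z ∈ names Γ × x ≡ Embedding.u eΔ z × y ≡ Embedding.u eΦ z))) →
  let M = mixin Γ Δ (Embedding.u eΦ) (Embedding.rest eΦ) (var ∘ Embedding.u eΔ) πΔ πΦ
      C = combine Γ (Embedding.rest eΔ) (Embedding.rest eΦ) (Embedding.u eΔ) (Embedding.u eΦ) πΔ πΦ
  in Result.pres M ≡ Result.pres C
     × ViewEq Δ (Result.embedΔ M) (Result.embedΔ C)
     × ViewEq Φ (Result.viewΦ M) (Result.viewΦ C)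
     × ViewEq Γ (Result.diag M) (Result.diag C)
     × (∀ (Ω : Ctx) (wΔ wΦ : View) → WF Ω → IsView Δ Ω wΔ → IsView Φ Ω wΦ →
          ViewEquiv Γ Ω (compose Δ (var ∘ Embedding.u eΔ) wΔ) (compose Φ (var ∘ Embedding.u eΦ) wΦ) →
          ViewEq (Result.pres C) (Result.mediate M wΔ wΦ) (Result.mediate C wΔ wΦ))
theorem2 T Γ Δ Φ wfΓ _ _ eΔ eΦ πΔ πΦ _ _ combine-condition =
  let pres , embedΔ , viewΦ , diag , mediate =
        mixin≡combine T wfΓ (u eΔ) (u eΦ) (rest eΔ) (rest eΦ) πΔ πΦ (decomp eΔ) (decomp eΦ) shared
  in pres , embedΔ , viewΦ , diag , λ _ wΔ wΦ _ _ _ _ → mediate wΔ wΦ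
  where
    open Theory T
    open Embedding
    shared : ∀ {z} → z ∈ names Γ → πΔ (u eΔ z) ≡ πΦ (u eΦ z)
    shared z∈Γ = Equivalence.from (combine-condition _ _ (embedded-∈ T eΔ z∈Γ) (embedded-∈ T eΦ z∈Γ))
                   (_ , z∈Γ , refl , refl)
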